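{- Let $F$ be a non-archimedean ordered field, $\mathcal{C}$ the set of all convex subgroups of $(F,+)$, and $Q=\{a+A: a\in F, A\in\mathcal{C}\}$. For $\alpha,\beta\in Q$ define $\alpha\le\beta$ iff $(\forall x\in\alpha)(\exists y\in\beta)(x\le y)$. Then $\le$ is a total order relation on $Q$, and for all $\alpha,\beta,\gamma\in Q$: 1. if $\alpha\le\beta$ then $\alpha+\gamma\le\beta+\gamma$; 2. if $e(\alpha)<\alpha$ and $\beta\le\gamma$, then $\alpha\beta\le\alpha\gamma$; 3. for every magnitude $A\in\mathcal{C}$: if $e(\beta)\le\beta\le\gamma$ then $A\beta\le A\gamma$.
   Context: A subset of $F$ is convex if it contains every element lying between two of its elements. Every $\alpha\in Q$ can be written $\alpha=a+A$ with $a\in F$, $A\in\mathcal{C}$; $A$ is uniquely determined and is denoted $e(\alpha)$. Addition and multiplication on $Q$ are defined by: if $\alpha=a+A$, $\beta=b+B$, then $\alpha+\beta=a+b+A+B$ and $\alpha\beta=ab+aB+bA+AB$ (sums and products of sets taken elementwise, $aB=\{ay:y\in B\}$, $AB=\{xy: x\in A,y\in B\}$); these do not depend on the chosen representatives. Magnitudes $A\in\mathcal{C}$ are themselves elements of $Q$ (as $0+A$). We write $\alpha<\beta$ iff $\alpha\le\beta$ and $\alpha\cap\beta=\emptyset$. -}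

module Defs where

open import Level using (0ℓ)
open import Data.Nat using (ℕ; zero; suc)
open import Data.Product using (Σ; ∃; _×_; _,_)
open import Data.Sum using (_⊎_)
open import Relation.Nullary using (¬_)
open import Relation.Unary using (Pred)
open import Relation.Binary using (Rel; IsTotalOrder)
open import Relation.Binary.PropositionalEquality using (_≡_)
open import Algebra.Structures using (IsCommutativeRing)

record OrderedField : Set₁ where
  infixl 6 _+_
  infixl 7 _*_
  infix 4 _≤_
  field
    Carrier : Set
    _+_ _*_ : Carrier → Carrier → Carrier
    -_ : Carrier → Carrier
    0# 1# : Carrier
    _≤_ : Rel Carrier 0ℓ
    isCommutativeRing : IsCommutativeRing _≡_ _+_ _*_ -_ 0# 1#
    0≢1 : ¬ (0# ≡ 1#)
    inverse : ∀ x → ¬ (x ≡ 0#) → ∃ λ y → x * y ≡ 1#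
    isTotalOrder : IsTotalOrder _≡_ _≤_
    +-mono-≤ : ∀ x y z → x ≤ y → x + z ≤ y + z
    *-nonneg : ∀ x y → 0# ≤ x → 0# ≤ y → 0# ≤ x * y

module OF (F : OrderedField) where
  open OrderedField F

  _<_ : Rel Carrier 0ℓ
  x < y = x ≤ y × ¬ (x ≡ y)

  fromℕ : ℕ → Carrier
  fromℕ zero = 0#
  fromℕ (suc n) = 1# + fromℕ n

  NonArchimedean : Set
  NonArchimedean = ∃ λ x → ∀ (n : ℕ) → fromℕ n < x

  Subset : Set₁
  Subset = Pred Carrier 0ℓ

  record IsConvexSubgroup (A : Subset) : Set where
    field
      has-0 : A 0#
      +-closed : ∀ {x y} → A x → A y → A (x + y)
      neg-closed : ∀ {x} → A x → A (- x)
      convex : ∀ {x y z} → A x → A y → x ≤ z → z ≤ y → A z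

  -- an element of Q, given with a representation a + A
  record QElt : Set₁ where
    constructor _⊕_∣_
    field
      rep : Carrier
      mag : Subset
      mag-conv : IsConvexSubgroup mag

  open QElt public

  ⟦_⟧ : QElt → Subset
  ⟦ α ⟧ x = ∃ λ y → mag α y × x ≡ rep α + y

  e : QElt → QElt
  e α = 0# ⊕ mag α ∣ mag-conv α

  _+Q_ : QElt → QElt → Subset
  (α +Q β) x = ∃ λ u → ∃ λ v → mag α u × mag β v × x ≡ rep α + rep β + u + v

  _*Q_ : QElt → QElt → Subset
  (α *Q β) x = ∃ λ v → ∃ λ u → ∃ λ u' → ∃ λ v' →
      mag β v × mag α u × mag α u' × mag β v' ×
      x ≡ rep α * rep β + rep α * v + rep β * u + u' * v'

  _≤S_ : Subset → Subset → Set
  X ≤S Y = ∀ x → X x → ∃ λ y → Y y × x ≤ y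

  _<S_ : Subset → Subset → Set
  X <S Y = X ≤S Y × (∀ x → X x → ¬ Y x)

  _≐_ : Subset → Subset → Set
  X ≐ Y = (∀ x → X x → Y x) × (∀ x → Y x → X x)

  -- ≤ is a total order on Q (equality of elements of Q = equality of sets)
  IsTotalOrderOnQ : Set₁
  IsTotalOrderOnQ =
    (∀ α → ⟦ α ⟧ ≤S ⟦ α ⟧) ×
    (∀ α β γ → ⟦ α ⟧ ≤S ⟦ β ⟧ → ⟦ β ⟧ ≤S ⟦ γ ⟧ → ⟦ α ⟧ ≤S ⟦ γ ⟧) ×
    (∀ α β → ⟦ α ⟧ ≤S ⟦ β ⟧ → ⟦ β ⟧ ≤S ⟦ α ⟧ → ⟦ α ⟧ ≐ ⟦ β ⟧) ×
    (∀ α β → ⟦ α ⟧ ≤S ⟦ β ⟧ ⊎ ⟦ β ⟧ ≤S ⟦ α ⟧)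

module Submission where

-- Antisymmetry: if α ≤ β ≤ α, a point of α
--     either lies between two points of β or forces rep β ∈ α, and a point
--     shared by α and β yields mag α ⊆ mag β (Cosets).
--  4. Sum and product sets contain all sums and products of their points.
--     So addition is monotone, and α β ≤ α γ whenever β ≤ γ and every element
--     of α β lies below some s t with 0 ≤ s ∈ α, t ∈ β.  This domination
--     holds when e(α) < α (then rep α bounds mag α) and when α is a magnitude
--     and e(β) ≤ β (then ∣ rep β ∣ ∈ β).
-- The theorem collects these facts; the argument does not need F to be
-- non-archimedean.

open import Defs
open import Level using (0ℓ)
open import Data.Maybe using (nothing)
open import Data.Product using (_×_; _,_; ∃; ∃₂; proj₁; proj₂)
open import Data.Sum using (_⊎_; inj₁; inj₂)
open import Data.Empty using (⊥-elim)
open import Relation.Nullary using (¬_; yes; no)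
open import Relation.Unary using (Pred)
open import Relation.Binary using (Rel; Reflexive; Transitive; Total; IsTotalOrder; Poset)
open import Relation.Binary.PropositionalEquality using (_≡_; refl; sym; trans; cong; cong₂; subst; subst₂)
open import Algebra.Bundles using (CommutativeRing)
open import Algebra.Structures using (IsCommutativeRing)
open import Axiom.ExcludedMiddle using (ExcludedMiddle)
open import Tactic.RingSolver.Core.AlmostCommutativeRing using (fromCommutativeRing)
import Relation.Binary.Reasoning.PartialOrder

module UpperCofinality {A : Set} (_≤_ : Rel A 0ℓ) where

  _≼_ : Pred A 0ℓ → Pred A 0ℓ → Set
  X ≼ Y = ∀ x → X x → ∃ λ y → Y y × x ≤ y

  ≼-refl : Reflexive _≤_ → ∀ X → X ≼ X
  ≼-refl ≤-refl X x x∈X = x , x∈X , ≤-refl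

  ≼-trans : Transitive _≤_ → ∀ {X Y Z} → X ≼ Y → Y ≼ Z → X ≼ Z
  ≼-trans ≤-trans X≼Y Y≼Z x x∈X with X≼Y x x∈X
  ... | y , y∈Y , x≤y with Y≼Z y y∈Y
  ...   | z , z∈Z , y≤z = z , z∈Z , ≤-trans x≤y y≤z

  -- Classically: if X ⋠ Y, each y ∈ Y is below some x ∈ X, for otherwise y
  -- would lie above all of X (by totality) and X ≼ Y would hold.
  ≼-total : ExcludedMiddle 0ℓ → Total _≤_ → ∀ X Y → X ≼ Y ⊎ Y ≼ X
  ≼-total em total X Y with em {X ≼ Y}
  ... | yes X≼Y = inj₁ X≼Y
  ... | no X⋠Y = inj₂ Y≼X
    where
    Y≼X : Y ≼ X
    Y≼X y y∈Y with em {∃ λ x → X x × y ≤ x}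
    ... | yes bound = bound
    ... | no unbounded = ⊥-elim (X⋠Y X≼Y)
      where
      X≼Y : X ≼ Y
      X≼Y x x∈X with total x y
      ... | inj₁ x≤y = y , y∈Y , x≤y
      ... | inj₂ y≤x = ⊥-elim (unbounded (x , x∈X , y≤x))

module OrderedFieldArithmetic (F : OrderedField) where
  open OrderedField F public
  open IsTotalOrder isTotalOrder public using ()
    renaming (refl to ≤-refl; trans to ≤-trans; total to ≤-total; antisym to ≤-antisym)
  open IsCommutativeRing isCommutativeRing public
    using (+-identityˡ; +-identityʳ; +-comm; +-assoc; distribˡ; distribʳ; *-comm; zeroˡ; -‿inverseˡ; -‿inverseʳ)

  commutativeRing : CommutativeRing 0ℓ 0ℓ
  commutativeRing = record { isCommutativeRing = isCommutativeRing }

  open import Tactic.RingSolver.NonReflective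
    (fromCommutativeRing commutativeRing (λ _ → nothing)) public
    using (solve; _⊜_; _⊕_; _⊗_; ⊝_)

  poset : Poset 0ℓ 0ℓ 0ℓ
  poset = record { isPartialOrder = IsTotalOrder.isPartialOrder isTotalOrder }

  module ≤-Reasoning = Relation.Binary.Reasoning.PartialOrder poset

  infixl 6 _-_
  _-_ : Carrier → Carrier → Carrier
  x - y = x + - y

  open ≤-Reasoning

  +-monoˡ-≤ : ∀ {x y} z → x ≤ y → x + z ≤ y + z
  +-monoˡ-≤ z x≤y = +-mono-≤ _ _ z x≤y

  +-monoʳ-≤ : ∀ {x y} z → x ≤ y → z + x ≤ z + y
  +-monoʳ-≤ {x} {y} z x≤y = subst₂ _≤_ (+-comm x z) (+-comm y z) (+-monoˡ-≤ z x≤y)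

  +-mono₂-≤ : ∀ {x y u v} → x ≤ y → u ≤ v → x + u ≤ y + v
  +-mono₂-≤ {y = y} {u} x≤y u≤v = ≤-trans (+-monoˡ-≤ u x≤y) (+-monoʳ-≤ y u≤v)

  x≤x+y : ∀ {x y} → 0# ≤ y → x ≤ x + y
  x≤x+y {x} {y} 0≤y = begin
    x      ≡⟨ sym (+-identityʳ x) ⟩
    x + 0# ≤⟨ +-monoʳ-≤ x 0≤y ⟩
    x + y  ∎

  y≤x+y : ∀ {x y} → 0# ≤ x → y ≤ x + y
  y≤x+y {x} {y} 0≤x = subst (y ≤_) (+-comm y x) (x≤x+y 0≤x)

  open import Algebra.Properties.Ring (CommutativeRing.ring commutativeRing) public
    using (xyx⁻¹≈y; //-rightDividesˡ; \\-leftDividesˡ; -0#≈0#; -‿involutive; -‿distribˡ-*; -‿distribʳ-*;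
           x[y-z]≈xy-xz)

  0≤y-x⇒x≤y : ∀ {x y} → 0# ≤ y - x → x ≤ y
  0≤y-x⇒x≤y {x} {y} 0≤y-x = begin
    x           ≡⟨ sym (+-identityˡ x) ⟩
    0# + x      ≤⟨ +-monoˡ-≤ x 0≤y-x ⟩
    (y - x) + x ≡⟨ //-rightDividesˡ x y ⟩
    y           ∎

  0≤y+x⇒-x≤y : ∀ {x y} → 0# ≤ y + x → - x ≤ y
  0≤y+x⇒-x≤y {x} {y} 0≤y+x = 0≤y-x⇒x≤y (subst (0# ≤_) (cong (y +_) (sym (-‿involutive x))) 0≤y+x)

  -x≤y⇒0≤y+x : ∀ {x y} → - x ≤ y → 0# ≤ y + x
  -x≤y⇒0≤y+x {x} {y} -x≤y = begin
    0#       ≡⟨ sym (-‿inverseˡ x) ⟩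
    - x + x  ≤⟨ +-monoˡ-≤ x -x≤y ⟩
    y + x    ∎

  x≤y⇒0≤y-x : ∀ {x y} → x ≤ y → 0# ≤ y - x
  x≤y⇒0≤y-x {x} {y} x≤y = begin
    0#     ≡⟨ sym (-‿inverseʳ x) ⟩
    x - x  ≤⟨ +-monoˡ-≤ (- x) x≤y ⟩
    y - x  ∎

  neg-antitone : ∀ {x y} → x ≤ y → - y ≤ - x
  neg-antitone {x} {y} x≤y = 0≤y+x⇒-x≤y (subst (0# ≤_) (+-comm y (- x)) (x≤y⇒0≤y-x x≤y))

  nonpos⇒0≤neg : ∀ {x} → x ≤ 0# → 0# ≤ - x
  nonpos⇒0≤neg x≤0 = subst (_≤ _) -0#≈0# (neg-antitone x≤0)

  *-monoʳ-≤ : ∀ {m x y} → 0# ≤ m → x ≤ y → m * x ≤ m * y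
  *-monoʳ-≤ {m} {x} {y} 0≤m x≤y = 0≤y-x⇒x≤y (begin
    0#                ≤⟨ *-nonneg m (y - x) 0≤m (x≤y⇒0≤y-x x≤y) ⟩
    m * (y - x)       ≡⟨ x[y-z]≈xy-xz m y x ⟩
    m * y - m * x     ∎)

  *-monoˡ-≤ : ∀ {m x y} → 0# ≤ m → x ≤ y → x * m ≤ y * m
  *-monoˡ-≤ {m} {x} {y} 0≤m x≤y = subst₂ _≤_ (*-comm m x) (*-comm m y) (*-monoʳ-≤ 0≤m x≤y)

  -x*-y≡x*y : ∀ x y → - x * - y ≡ x * y
  -x*-y≡x*y x y = trans (sym (-‿distribˡ-* x (- y)))
                 (trans (cong -_ (sym (-‿distribʳ-* x y))) (-‿involutive (x * y)))

  ∣_∣ : Carrier → Carrier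
  ∣ x ∣ with ≤-total 0# x
  ... | inj₁ _ = x
  ... | inj₂ _ = - x

  0≤∣x∣ : ∀ x → 0# ≤ ∣ x ∣
  0≤∣x∣ x with ≤-total 0# x
  ... | inj₁ 0≤x = 0≤x
  ... | inj₂ x≤0 = nonpos⇒0≤neg x≤0

  x≤∣x∣ : ∀ x → x ≤ ∣ x ∣
  x≤∣x∣ x with ≤-total 0# x
  ... | inj₁ _   = ≤-refl
  ... | inj₂ x≤0 = ≤-trans x≤0 (nonpos⇒0≤neg x≤0)

  -x≤∣x∣ : ∀ x → - x ≤ ∣ x ∣
  -x≤∣x∣ x with ≤-total 0# x
  ... | inj₁ 0≤x = ≤-trans (subst (_ ≤_) -0#≈0# (neg-antitone 0≤x)) 0≤x
  ... | inj₂ _   = ≤-refl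

  -∣x∣≤x : ∀ x → - ∣ x ∣ ≤ x
  -∣x∣≤x x = subst (- ∣ x ∣ ≤_) (-‿involutive x) (neg-antitone (-x≤∣x∣ x))

  ∣x∣≡x : ∀ {x} → 0# ≤ x → ∣ x ∣ ≡ x
  ∣x∣≡x {x} 0≤x with ≤-total 0# x
  ... | inj₁ _   = refl
  ... | inj₂ x≤0 = trans (cong -_ (sym 0≡x)) (trans -0#≈0# 0≡x)
    where 0≡x = ≤-antisym 0≤x x≤0

  x*y≤∣x∣*∣y∣ : ∀ x y → x * y ≤ ∣ x ∣ * ∣ y ∣
  x*y≤∣x∣*∣y∣ x y with ≤-total 0# x
  ... | inj₁ 0≤x = *-monoʳ-≤ 0≤x (x≤∣x∣ y)
  ... | inj₂ x≤0 = subst (_≤ - x * ∣ y ∣) (-x*-y≡x*y x y) (*-monoʳ-≤ (nonpos⇒0≤neg x≤0) (-x≤∣x∣ y))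

  *-≤-bound : ∀ {x m} y → ∣ x ∣ ≤ m → x * y ≤ m * ∣ y ∣
  *-≤-bound {x} y ∣x∣≤m = ≤-trans (x*y≤∣x∣*∣y∣ x y) (*-monoˡ-≤ (0≤∣x∣ y) ∣x∣≤m)

  y+[x-y]≡x : ∀ x y → y + (x - y) ≡ x
  y+[x-y]≡x x y = trans (+-comm y (x - y)) (//-rightDividesˡ y x)

module Cosets (F : OrderedField) where
  open OrderedFieldArithmetic F
  open OF F
  open ≤-Reasoning

  module ConvexSubgroup {A : Subset} (cA : IsConvexSubgroup A) where
    open IsConvexSubgroup cA

    abs-closed : ∀ {x} → A x → A ∣ x ∣
    abs-closed {x} x∈A with ≤-total 0# x
    ... | inj₁ _ = x∈A
    ... | inj₂ _ = neg-closed x∈A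

    abs-reflect : ∀ {x} → A ∣ x ∣ → A x
    abs-reflect {x} ∣x∣∈A = convex (neg-closed ∣x∣∈A) ∣x∣∈A (-∣x∣≤x x) (x≤∣x∣ x)

    -- A non-negative element outside A lies above every ∣ t ∣ with t ∈ A,
    -- since otherwise convexity would put it into A.
    outside-dominates : ∀ {a t} → ¬ A a → 0# ≤ a → A t → ∣ t ∣ ≤ a
    outside-dominates {a} {t} a∉A 0≤a t∈A with ≤-total ∣ t ∣ a
    ... | inj₁ ∣t∣≤a = ∣t∣≤a
    ... | inj₂ a≤∣t∣ = ⊥-elim (a∉A (convex has-0 (abs-closed t∈A) 0≤a a≤∣t∣))

  open ConvexSubgroup using (abs-closed; abs-reflect; outside-dominates)

  rep∈ : ∀ α → ⟦ α ⟧ (rep α)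
  rep∈ α = 0# , IsConvexSubgroup.has-0 (mag-conv α) , sym (+-identityʳ (rep α))

  diff∈mag⇒∈ : ∀ α {x} → mag α (x - rep α) → ⟦ α ⟧ x
  diff∈mag⇒∈ α {x} d∈A = x - rep α , d∈A , sym (y+[x-y]≡x x (rep α))

  coset-diff : ∀ α {y z} → ⟦ α ⟧ y → ⟦ α ⟧ z → mag α (y - z)
  coset-diff (a ⊕ A ∣ cA) (v , v∈A , refl) (w , w∈A , refl) =
    subst A (sym a+v-[a+w]≡v-w) (+-closed v∈A (neg-closed w∈A))
    where
    open IsConvexSubgroup cA
    a+v-[a+w]≡v-w : (a + v) - (a + w) ≡ v - w
    a+v-[a+w]≡v-w = begin-equality
      (a + v) - (a + w)     ≡⟨ solve 3 (λ a v w → ((a ⊕ v) ⊕ ⊝ (a ⊕ w)) ⊜ ((v ⊕ ⊝ w) ⊕ (a ⊕ ⊝ a))) refl a v w ⟩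
      (v - w) + (a - a)     ≡⟨ cong ((v - w) +_) (-‿inverseʳ a) ⟩
      (v - w) + 0#          ≡⟨ +-identityʳ (v - w) ⟩
      v - w                 ∎

  coset-shift : ∀ α {y t} → ⟦ α ⟧ y → mag α t → ⟦ α ⟧ (y + t)
  coset-shift (a ⊕ A ∣ cA) {t = t} (v , v∈A , refl) t∈A =
    v + t , IsConvexSubgroup.+-closed cA v∈A t∈A , +-assoc a v t

  coset-convex : ∀ α {x y z} → ⟦ α ⟧ y → ⟦ α ⟧ z → y ≤ x → x ≤ z → ⟦ α ⟧ x
  coset-convex α y∈α z∈α y≤x x≤z = diff∈mag⇒∈ α
    (IsConvexSubgroup.convex (mag-conv α)
      (coset-diff α y∈α (rep∈ α)) (coset-diff α z∈α (rep∈ α))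
      (+-monoˡ-≤ (- rep α) y≤x) (+-monoˡ-≤ (- rep α) x≤z))

  -- If α ≤ β and the cosets share a point c, then mag α ⊆ mag β: for d in
  -- mag α, c + ∣ d ∣ ∈ α is below some y ∈ β, so 0 ≤ ∣ d ∣ ≤ y - c ∈ mag β.
  shared-point⇒mag⊆ : ∀ α β {c d} → ⟦ α ⟧ ≤S ⟦ β ⟧ → ⟦ α ⟧ c → ⟦ β ⟧ c →
                      mag α d → mag β d
  shared-point⇒mag⊆ α β {c} {d} α≤β c∈α c∈β d∈A
    with α≤β (c + ∣ d ∣) (coset-shift α c∈α (abs-closed (mag-conv α) d∈A))
  ... | y , y∈β , c+∣d∣≤y = abs-reflect cB
        (IsConvexSubgroup.convex cB (IsConvexSubgroup.has-0 cB) (coset-diff β y∈β c∈β)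
          (0≤∣x∣ d) ∣d∣≤y-c)
    where
    cB = mag-conv β
    ∣d∣≤y-c : ∣ d ∣ ≤ y - c
    ∣d∣≤y-c = begin
      ∣ d ∣         ≡⟨ sym (xyx⁻¹≈y c ∣ d ∣) ⟩
      c + ∣ d ∣ - c ≤⟨ +-monoˡ-≤ (- c) c+∣d∣≤y ⟩
      y - c         ∎

  -- Antisymmetry: if α ≤ β ≤ α then α ⊆ β.  A point x ∈ α above rep β lies
  -- between two points of β; a point below rep β makes rep β a shared point.
  ≤S-both⇒⊆ : ∀ α β → ⟦ α ⟧ ≤S ⟦ β ⟧ → ⟦ β ⟧ ≤S ⟦ α ⟧ → ∀ x → ⟦ α ⟧ x → ⟦ β ⟧ x
  ≤S-both⇒⊆ α β α≤β β≤α x x∈α with α≤β x x∈α | ≤-total (rep β) x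
  ... | y , y∈β , x≤y | inj₁ b≤x = coset-convex β (rep∈ β) y∈β b≤x x≤y
  ... | _             | inj₂ x≤b = diff∈mag⇒∈ β
        (shared-point⇒mag⊆ α β α≤β b∈α (rep∈ β) (coset-diff α x∈α b∈α))
    where
    b∈α : ⟦ α ⟧ (rep β)
    b∈α with β≤α (rep β) (rep∈ β)
    ... | z , z∈α , b≤z = coset-convex α x∈α z∈α x≤b b≤z

  ≤S-antisym : ∀ α β → ⟦ α ⟧ ≤S ⟦ β ⟧ → ⟦ β ⟧ ≤S ⟦ α ⟧ → ⟦ α ⟧ ≐ ⟦ β ⟧
  ≤S-antisym α β α≤β β≤α = ≤S-both⇒⊆ α β α≤β β≤α , ≤S-both⇒⊆ β α β≤α α≤β

  +Q-intro : ∀ α γ {y z} → ⟦ α ⟧ y → ⟦ γ ⟧ z → (α +Q γ) (y + z)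
  +Q-intro (a ⊕ _ ∣ _) (c ⊕ _ ∣ _) (u , u∈A , refl) (w , w∈C , refl) =
    u , w , u∈A , w∈C , solve 4 (λ a c u w → ((a ⊕ u) ⊕ (c ⊕ w)) ⊜ (a ⊕ c ⊕ u ⊕ w)) refl a c u w

  -- Item 1: an element (a + u) + (c + w) of α + γ is below y + (c + w) ∈ β + γ,
  -- where y ∈ β is above a + u.
  +Q-monoˡ : ∀ α β γ → ⟦ α ⟧ ≤S ⟦ β ⟧ → (α +Q γ) ≤S (β +Q γ)
  +Q-monoˡ (a ⊕ _ ∣ _) β γ@(c ⊕ _ ∣ _) α≤β x (u , w , u∈A , w∈C , refl)
    with α≤β (a + u) (u , u∈A , refl)
  ... | y , y∈β , a+u≤y = y + (c + w) , +Q-intro β γ y∈β (w , w∈C , refl) , (begin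
      a + c + u + w      ≡⟨ solve 4 (λ a c u w → (a ⊕ c ⊕ u ⊕ w) ⊜ ((a ⊕ u) ⊕ (c ⊕ w))) refl a c u w ⟩
      (a + u) + (c + w)  ≤⟨ +-monoˡ-≤ (c + w) a+u≤y ⟩
      y + (c + w)        ∎)

  *Q-intro : ∀ α γ {s t} → ⟦ α ⟧ s → ⟦ γ ⟧ t → (α *Q γ) (s * t)
  *Q-intro (a ⊕ _ ∣ _) (c ⊕ _ ∣ _) (u , u∈A , refl) (w , w∈C , refl) =
    w , u , u , w , w∈C , u∈A , u∈A , w∈C ,
    solve 4 (λ a c u w → ((a ⊕ u) ⊗ (c ⊕ w)) ⊜ (a ⊗ c ⊕ a ⊗ w ⊕ c ⊗ u ⊕ u ⊗ w)) refl a c u w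

  DominatedByProducts : QElt → QElt → Set
  DominatedByProducts α β =
    ∀ x → (α *Q β) x → ∃₂ λ s t → ⟦ α ⟧ s × 0# ≤ s × ⟦ β ⟧ t × x ≤ s * t

  -- Domination reduces monotonicity of α · _ to monotonicity of s * _ for s ≥ 0.
  *Q-mono-dominated : ∀ α β γ → DominatedByProducts α β → ⟦ β ⟧ ≤S ⟦ γ ⟧ →
                      (α *Q β) ≤S (α *Q γ)
  *Q-mono-dominated α β γ dominated β≤γ x x∈αβ with dominated x x∈αβ
  ... | s , t , s∈α , 0≤s , t∈β , x≤st with β≤γ t t∈β
  ...   | t' , t'∈γ , t≤t' = s * t' , *Q-intro α γ s∈α t'∈γ , ≤-trans x≤st (*-monoʳ-≤ 0≤s t≤t')

  -- If e(α) ≤ α, then a non-positive representative lies in the magnitude: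
  -- 0 ∈ e(α) lies below some rep α + t, so - t ≤ rep α ≤ 0.
  nonpos-rep∈mag : ∀ α → ⟦ e α ⟧ ≤S ⟦ α ⟧ → rep α ≤ 0# → mag α (rep α)
  nonpos-rep∈mag α@(a ⊕ A ∣ cA) e≤α a≤0 with e≤α 0# (rep∈ (e α))
  ... | _ , (t , t∈A , refl) , 0≤a+t =
        convex (neg-closed t∈A) has-0 (0≤y+x⇒-x≤y 0≤a+t) a≤0
    where open IsConvexSubgroup cA

  ∣rep∣∈ : ∀ β → ⟦ e β ⟧ ≤S ⟦ β ⟧ → ⟦ β ⟧ ∣ rep β ∣
  ∣rep∣∈ β e≤β with ≤-total 0# (rep β)
  ... | inj₁ _   = rep∈ β
  ... | inj₂ b≤0 = subst ⟦ β ⟧ (\\-leftDividesˡ b (- b))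
                     (coset-shift β (rep∈ β) (+-closed -b∈B -b∈B))
    where
    open IsConvexSubgroup (mag-conv β)
    b = rep β
    -b∈B = neg-closed (nonpos-rep∈mag β e≤β b≤0)

  -- If e(α) < α, then rep α is a non-negative element outside mag α, and
  -- therefore dominates every element of mag α.
  module AboveMagnitude α (e<α : ⟦ e α ⟧ <S ⟦ α ⟧) where
    rep∉mag : ¬ mag α (rep α)
    rep∉mag a∈A = proj₂ e<α (rep α) (mag⊆e a∈A) (rep∈ α)
      where
      mag⊆e : ∀ {t} → mag α t → ⟦ e α ⟧ t
      mag⊆e {t} t∈A = t , t∈A , sym (+-identityˡ t)

    0≤rep : 0# ≤ rep α
    0≤rep with ≤-total 0# (rep α)
    ... | inj₁ 0≤a = 0≤a
    ... | inj₂ a≤0 = ⊥-elim (rep∉mag (nonpos-rep∈mag α (proj₁ e<α) a≤0))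

    mag≤rep : ∀ {t} → mag α t → ∣ t ∣ ≤ rep α
    mag≤rep = outside-dominates (mag-conv α) rep∉mag 0≤rep

    0≤rep+mag : ∀ {t} → mag α t → 0# ≤ rep α + t
    0≤rep+mag {t} t∈A = -x≤y⇒0≤y+x (≤-trans (-x≤∣x∣ t) (mag≤rep t∈A))

  -- Writing an
  -- element as ab + av + bu + u'v', take s = a + u ≥ 0; since ∣ a ∣, ∣ u' ∣ ≤ a ≤ 2s,
  -- the terms av + u'v' are at most s V with V = 2(∣ v ∣ + ∣ v' ∣) ∈ mag β.
  above-magnitude-dominates : ∀ α β → ⟦ e α ⟧ <S ⟦ α ⟧ → DominatedByProducts α β
  above-magnitude-dominates α@(a ⊕ _ ∣ cA) β@(b ⊕ B ∣ cB) e<α x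
    (v , u , u' , v' , v∈B , u∈A , u'∈A , v'∈B , refl) =
    s , b + V , (u , u∈A , refl) , 0≤rep+mag u∈A , coset-shift β (rep∈ β) V∈B , bound
    where
    open AboveMagnitude α e<α
    open IsConvexSubgroup cA using () renaming (+-closed to +-closedᴬ)
    open IsConvexSubgroup cB using () renaming (+-closed to +-closedᴮ)
    s = a + u
    p = ∣ v ∣ + ∣ v' ∣
    V = p + p
    V∈B : B V
    V∈B = +-closedᴮ p∈B p∈B
      where p∈B = +-closedᴮ (abs-closed cB v∈B) (abs-closed cB v'∈B)
    a≤s+s : a ≤ s + s
    a≤s+s = begin
      a                  ≤⟨ x≤x+y (0≤rep+mag (+-closedᴬ u∈A u∈A)) ⟩
      a + (a + (u + u))  ≡⟨ solve 2 (λ a u → (a ⊕ (a ⊕ (u ⊕ u))) ⊜ ((a ⊕ u) ⊕ (a ⊕ u))) refl a u ⟩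
      s + s              ∎
    ∣a∣≤s+s : ∣ a ∣ ≤ s + s
    ∣a∣≤s+s = subst (_≤ s + s) (sym (∣x∣≡x 0≤rep)) a≤s+s
    ∣u'∣≤s+s : ∣ u' ∣ ≤ s + s
    ∣u'∣≤s+s = ≤-trans (mag≤rep u'∈A) a≤s+s
    bound : a * b + a * v + b * u + u' * v' ≤ s * (b + V)
    bound = begin
      a * b + a * v + b * u + u' * v'
        ≡⟨ solve 6 (λ a b u v u' v' → (a ⊗ b ⊕ a ⊗ v ⊕ b ⊗ u ⊕ u' ⊗ v')
                                    ⊜ ((a ⊕ u) ⊗ b ⊕ (a ⊗ v ⊕ u' ⊗ v'))) refl a b u v u' v' ⟩
      s * b + (a * v + u' * v')
        ≤⟨ +-monoʳ-≤ (s * b) (+-mono₂-≤ (*-≤-bound v ∣a∣≤s+s) (*-≤-bound v' ∣u'∣≤s+s)) ⟩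
      s * b + ((s + s) * ∣ v ∣ + (s + s) * ∣ v' ∣)
        ≡⟨ cong (s * b +_) (sym (distribˡ (s + s) ∣ v ∣ ∣ v' ∣)) ⟩
      s * b + (s + s) * p
        ≡⟨ cong (s * b +_) (trans (distribʳ p s s) (sym (distribˡ s p p))) ⟩
      s * b + s * V
        ≡⟨ sym (distribˡ s b V) ⟩
      s * (b + V)
        ∎

  -- An element of A β is bu + u'v' (up to zero terms); with
  -- m = ∣ u ∣ + ∣ u' ∣ ∈ A it is at most m (∣ b ∣ + ∣ v' ∣), a product with
  -- ∣ b ∣ + ∣ v' ∣ ∈ β.
  magnitude-dominates : ∀ A (cA : IsConvexSubgroup A) β → ⟦ e β ⟧ ≤S ⟦ β ⟧ →
                        DominatedByProducts (0# ⊕ A ∣ cA) β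
  magnitude-dominates A cA β@(b ⊕ _ ∣ cB) e≤β x
    (v , u , u' , v' , _ , u∈A , u'∈A , v'∈B , refl) =
    m , ∣ b ∣ + ∣ v' ∣ , (m , m∈A , sym (+-identityˡ m)) , 0≤m ,
    coset-shift β (∣rep∣∈ β e≤β) (abs-closed cB v'∈B) , bound
    where
    m = ∣ u ∣ + ∣ u' ∣
    m∈A : A m
    m∈A = IsConvexSubgroup.+-closed cA (abs-closed cA u∈A) (abs-closed cA u'∈A)
    0≤m : 0# ≤ m
    0≤m = ≤-trans (0≤∣x∣ u) (x≤x+y (0≤∣x∣ u'))
    bound : 0# * b + 0# * v + b * u + u' * v' ≤ m * (∣ b ∣ + ∣ v' ∣)
    bound = begin
      0# * b + 0# * v + b * u + u' * v'
        ≡⟨ cong (λ z → z + b * u + u' * v') (trans (cong₂ _+_ (zeroˡ b) (zeroˡ v)) (+-identityˡ 0#)) ⟩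
      0# + b * u + u' * v'
        ≡⟨ cong (_+ u' * v') (trans (+-identityˡ (b * u)) (*-comm b u)) ⟩
      u * b + u' * v'
        ≤⟨ +-mono₂-≤ (*-≤-bound b (x≤x+y (0≤∣x∣ u'))) (*-≤-bound v' (y≤x+y (0≤∣x∣ u))) ⟩
      m * ∣ b ∣ + m * ∣ v' ∣
        ≡⟨ sym (distribˡ m ∣ b ∣ ∣ v' ∣) ⟩
      m * (∣ b ∣ + ∣ v' ∣)
        ∎

theorem2p3 : ExcludedMiddle 0ℓ → (F : OrderedField) →
    let open OrderedField F using (0#) in
    let open OF F in
    NonArchimedean →
    IsTotalOrderOnQ ×
    (∀ α β γ → ⟦ α ⟧ ≤S ⟦ β ⟧ → (α +Q γ) ≤S (β +Q γ)) ×
    (∀ α β γ → ⟦ e α ⟧ <S ⟦ α ⟧ → ⟦ β ⟧ ≤S ⟦ γ ⟧ → (α *Q β) ≤S (α *Q γ)) ×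
    (∀ (A : Subset) (cA : IsConvexSubgroup A) β γ →
      ⟦ e β ⟧ ≤S ⟦ β ⟧ → ⟦ β ⟧ ≤S ⟦ γ ⟧ →
      ((0# ⊕ A ∣ cA) *Q β) ≤S ((0# ⊕ A ∣ cA) *Q γ))
theorem2p3 em F _ =
  ( ( (λ α → ≼-refl ≤-refl ⟦ α ⟧)
    , (λ α β γ → ≼-trans ≤-trans)
    , ≤S-antisym
    , (λ α β → ≼-total em ≤-total ⟦ α ⟧ ⟦ β ⟧) )
  , +Q-monoˡ
  , (λ α β γ e<α → *Q-mono-dominated α β γ (above-magnitude-dominates α β e<α))
  , (λ A cA β γ e≤β →
       *Q-mono-dominated (0# ⊕ A ∣ cA) β γ (magnitude-dominates A cA β e≤β)) )
  where
  open OrderedFieldArithmetic F using (_≤_; 0#; ≤-refl; ≤-trans; ≤-total)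
  open OF F using (⟦_⟧; _⊕_∣_)
  open UpperCofinality _≤_
  open Cosets F
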